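{- Let $A,B>0$, $q$ a natural number, and $f:\mathbb{Z}\to\mathbb{C}$ a function with $|f(m)|\le A$ and $f(m+q)=f(m)$ for all $m\in\mathbb{Z}$, and $\sum_{m=1}^{q}\left|\sum_{k=1}^{K}f(m+k)\right|^2\le BqK$ for all natural $K$. Fix an integer $n\ge0$, an integer $a$, and a positive integer $N$; let $\tau$ be the integer with $\frac{q_n^{\tau}-1}{2}\le N<\frac{q_n^{\tau+1}-1}{2}$, and for $0\le i\le\tau$ put $K_i=\frac{q_n^{\tau-i}-1}{2}$. Then for every $1\le i\le\tau$, \[ T_{ - }(a,K_{i-1})=2T_{ - }(a,q_{n-1}K_i+c_{n-1})-T_{+}(a-q_{n-2}K_i-c_{n-2},\,q_{n-2}K_i+c_{n-2})+S(a-q_{n-2}K_i-c_{n-2},\,(q_{n-2}+q_{n-1})K_i+c_n-c_{n-1}). \]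
   Context: The sequence $(q_n)_{n\ge -2}$ is defined by $q_{ -2}=q_{ -1}=1$, $q_n=2q_{n-1}+q_{n-2}$ for $n\ge0$; and $c_n=\frac{q_n-1}{2}$ for $n\ge-2$ (so $c_{ -2}=c_{ -1}=0$). For integers $x$ and $y\ge 0$: $T_{ - }(x,y)=\sum_{k=1}^{y}(y+1-k)f(x+k)$, $T_{+}(x,y)=\sum_{k=1}^{y}k f(x+k)$, and $S(x,y)=\sum_{i=x+1}^{x+y}\sum_{j=0}^{y-1}f(i+j)$. -}

module Defs where

open import Level using (Level)
open import Data.Nat as ℕ using (ℕ; zero; suc; _∸_; ⌊_/2⌋)
open import Data.Integer as ℤ using (ℤ; +_)
open import Algebra.Bundles using (CommutativeRing)

-- Shifted sequence: qs m = q_{m-2}, so qs 0 = q_{-2} = 1, qs 1 = q_{-1} = 1,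
-- qs (m+2) = q_m = 2 q_{m-1} + q_{m-2}.
qs : ℕ → ℕ
qs zero = 1
qs (suc zero) = 1
qs (suc (suc m)) = 2 ℕ.* qs (suc m) ℕ.+ qs m

q : ℕ → ℕ
q n = qs (2 ℕ.+ n)

-- cs m = c_{m-2} = (q_{m-2} - 1)/2 (q_{m-2} is always odd)
cs : ℕ → ℕ
cs m = ⌊ qs m ∸ 1 /2⌋

c : ℕ → ℕ
c n = cs (2 ℕ.+ n)

module Sums {c′ ℓ : Level} (R : CommutativeRing c′ ℓ) where
  open CommutativeRing R

  _·_ : ℕ → Carrier → Carrier
  zero · r = 0#
  suc k · r = r + (k · r)

  Σ₁ : ℕ → (ℕ → Carrier) → Carrier
  Σ₁ zero g = 0#
  Σ₁ (suc y) g = Σ₁ y g + g (suc y)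

  Σ₀ : ℕ → (ℕ → Carrier) → Carrier
  Σ₀ zero g = 0#
  Σ₀ (suc y) g = Σ₀ y g + g y

  module _ (f : ℤ → Carrier) where
    T₋ : ℤ → ℕ → Carrier
    T₋ x y = Σ₁ y (λ k → ((suc y) ∸ k) · f (x ℤ.+ + k))

    T₊ : ℤ → ℕ → Carrier
    T₊ x y = Σ₁ y (λ k → k · f (x ℤ.+ + k))

    -- S(x,y) = Σ_{i=x+1}^{x+y} Σ_{j=0}^{y-1} f(i+j)   (i = x + k, k = 1..y)
    S : ℤ → ℕ → Carrier
    S x y = Σ₁ y (λ k → Σ₀ y (λ j → f ((x ℤ.+ + k) ℤ.+ + j)))

module Submission where

-- The identity is a purely combinatorial fact about finite sums.
--
-- Fix g : ℕ → R with prefix sums  P m = Σ_{j<m} g j  and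
-- Q m = Σ_{j<m} P j.  Each of the three sums in the statement telescopes
-- into P and Q:
--   Σ_{k=1}^{y} (y+1-k) g(v+k) = Q(v+y+2) − Q(v+2) − y·P(v+1),
--   Σ_{k=1}^{v} k g(k)         = v·P(v+1) − Q(v+1),
--   Σ_{s=1}^{w} Σ_{j<w} g(s+j) = Q(2w+1) − 2·Q(w+1).
-- For L = 2u+v+1 and w = u+v+1 these give the "splitting identity"
--   T₋(L) = 2·T₋(u) − T₊(v) + S(w)   (windows shifted by v):
-- adding the same telescoping terms to both sides makes them equal.
--
-- All q_m are odd and c_m = (q_m − 1)/2; with
-- U = q_{n-1}K_i + c_{n-1}, V = q_{n-2}K_i + c_{n-2} one gets
-- K_{i-1} = 2U + V + 1 and the length of S equals U + V + 1.
-- The theorem is the splitting identity for g(j) = f(a − V + j).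

open import Defs
open import Level using (Level)
open import Data.Nat as ℕ using (ℕ; zero; suc; _∸_; _^_; ⌊_/2⌋)
open import Data.Integer as ℤ using (ℤ; +_)
open import Algebra.Bundles using (CommutativeRing)
import Data.Nat.Properties as NP
import Data.Integer.Properties as ℤP
import Data.Integer.Solver as ℤSolver
import Data.Nat.Solver as ℕSolver
open import Data.Maybe using (nothing)
open import Data.Product using (_×_)
open import Relation.Binary.PropositionalEquality as P using (_≡_)
import Tactic.RingSolver.Core.AlmostCommutativeRing as ACR
import Tactic.RingSolver.NonReflective as RingSolver

open ℕSolver.+-*-Solver using (solve; _:+_; _:*_; _:=_; con)

-- half x = ⌊(x − 1)/2⌋; for odd x it is the e with x = 2e + 1.
-- Note  cs m = half (qs m)  and  K j = half (q n ^ (τ ∸ j))  by definition.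
half : ℕ → ℕ
half x = ⌊ x ∸ 1 /2⌋

Odd : ℕ → Set
Odd x = x ≡ suc (half x ℕ.+ half x)

half-odd : ∀ {x} e → x ≡ suc (e ℕ.+ e) → half x ≡ e
half-odd e P.refl = P.sym (NP.n≡⌊n+n/2⌋ e)

odd-intro : ∀ {x} e → x ≡ suc (e ℕ.+ e) → Odd x
odd-intro e x≡ = P.trans x≡ (P.cong (λ t → suc (t ℕ.+ t)) (P.sym (half-odd e x≡)))

*-odd : ∀ {x y} → Odd x → Odd y →
        x ℕ.* y ≡ suc ((x ℕ.* half y ℕ.+ half x) ℕ.+ (x ℕ.* half y ℕ.+ half x))
*-odd {x} {y} ox oy = P.trans (P.cong (x ℕ.*_) oy) (expand x (half x) (half y) ox)
  where
  expand : ∀ x α β → x ≡ suc (α ℕ.+ α) →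
           x ℕ.* suc (β ℕ.+ β) ≡ suc ((x ℕ.* β ℕ.+ α) ℕ.+ (x ℕ.* β ℕ.+ α))
  expand ._ α β P.refl =
    solve 2 (λ α β → (con 1 :+ (α :+ α)) :* (con 1 :+ (β :+ β))
                  := con 1 :+ (((con 1 :+ (α :+ α)) :* β :+ α) :+ ((con 1 :+ (α :+ α)) :* β :+ α)))
          P.refl α β

half-* : ∀ {x y} → Odd x → Odd y → half (x ℕ.* y) ≡ x ℕ.* half y ℕ.+ half x
half-* ox oy = half-odd _ (*-odd ox oy)

^-odd : ∀ {x} → Odd x → ∀ e → Odd (x ^ e)
^-odd ox zero = P.refl
^-odd {x} ox (suc e) = odd-intro (x ℕ.* half (x ^ e) ℕ.+ half x) (*-odd ox (^-odd ox e))

-- 2(2α+1) + (2β+1) = 2(2α+β+1) + 1: the recursion of q preserves oddness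
-- and induces the recursion of c.
recursion-odd : ∀ {x y} → Odd x → Odd y →
  2 ℕ.* x ℕ.+ y ≡ suc (suc (half x ℕ.+ half x ℕ.+ half y) ℕ.+ suc (half x ℕ.+ half x ℕ.+ half y))
recursion-odd {x} {y} ox oy = P.trans (P.cong₂ (λ s t → 2 ℕ.* s ℕ.+ t) ox oy)
  (solve 2 (λ α β → con 2 :* (con 1 :+ (α :+ α)) :+ (con 1 :+ (β :+ β))
               := con 1 :+ ((con 1 :+ (α :+ α :+ β)) :+ (con 1 :+ (α :+ α :+ β))))
         P.refl (half x) (half y))

qs-odd : ∀ m → Odd (qs m)
qs-odd zero = P.refl
qs-odd (suc zero) = P.refl
qs-odd (suc (suc m)) =
  odd-intro (suc (cs (suc m) ℕ.+ cs (suc m) ℕ.+ cs m)) (recursion-odd (qs-odd (suc m)) (qs-odd m))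

c-rec : ∀ n → c n ≡ suc (cs (1 ℕ.+ n) ℕ.+ cs (1 ℕ.+ n) ℕ.+ cs n)
c-rec n = half-odd _ (recursion-odd (qs-odd (1 ℕ.+ n)) (qs-odd n))

-- K_{i-1} = q_n K_i + c_n: one more factor q_n in the odd power.
K-step : ∀ n τ i → 1 ℕ.≤ i → i ℕ.≤ τ →
  half (q n ^ (τ ∸ (i ∸ 1))) ≡ q n ℕ.* half (q n ^ (τ ∸ i)) ℕ.+ c n
K-step n τ (suc i) _ i<τ =
  P.trans (P.cong (λ e → half (q n ^ e)) (NP.+-∸-assoc 1 i<τ))
          (half-* (qs-odd (2 ℕ.+ n)) (^-odd (qs-odd (2 ℕ.+ n)) (τ ∸ suc i)))

module Windows (n k : ℕ) where
  U V : ℕ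
  U = qs (1 ℕ.+ n) ℕ.* k ℕ.+ cs (1 ℕ.+ n)
  V = qs n ℕ.* k ℕ.+ cs n

  long-window : q n ℕ.* k ℕ.+ c n ≡ suc (U ℕ.+ U ℕ.+ V)
  long-window = P.trans (P.cong (q n ℕ.* k ℕ.+_) (c-rec n))
    (solve 5 (λ x y k a b → (con 2 :* x :+ y) :* k :+ (con 1 :+ (a :+ a :+ b))
                        := con 1 :+ ((x :* k :+ a) :+ (x :* k :+ a) :+ (y :* k :+ b)))
           P.refl (qs (1 ℕ.+ n)) (qs n) k (cs (1 ℕ.+ n)) (cs n))

  square-side : (qs n ℕ.+ qs (1 ℕ.+ n)) ℕ.* k ℕ.+ c n ∸ cs (1 ℕ.+ n) ≡ suc (V ℕ.+ U)
  square-side = P.trans (P.cong (_∸ cs (1 ℕ.+ n)) sum) (NP.m+n∸n≡m (suc (V ℕ.+ U)) (cs (1 ℕ.+ n)))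
    where
    sum : (qs n ℕ.+ qs (1 ℕ.+ n)) ℕ.* k ℕ.+ c n ≡ suc (V ℕ.+ U) ℕ.+ cs (1 ℕ.+ n)
    sum = P.trans (P.cong ((qs n ℕ.+ qs (1 ℕ.+ n)) ℕ.* k ℕ.+_) (c-rec n))
      (solve 5 (λ x y k a b → (y :+ x) :* k :+ (con 1 :+ (a :+ a :+ b))
                          := (con 1 :+ ((y :* k :+ b) :+ (x :* k :+ a))) :+ a)
             P.refl (qs (1 ℕ.+ n)) (qs n) k (cs (1 ℕ.+ n)) (cs n))

module Telescoping {c′ ℓ : Level} (R : CommutativeRing c′ ℓ) where
  open CommutativeRing R
  open Sums R
  -- Without a zero test for R the solver only proves identities whose
  -- normal forms need no cancellation; every use below is a rearrangement.
  open RingSolver (ACR.fromCommutativeRing R (λ _ → nothing))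
    using (_⊜_; _⊕_; ⊝_) renaming (solve to ring-solve)
  open import Algebra.Properties.Group +-group using (x≈z//y; ∙-cancelʳ)
  open import Relation.Binary.Reasoning.Setoid setoid

  -- The solver's equation former _⊜_ binds as tightly as _⊕_; this alias
  -- lets equations be written without parenthesising both sides.
  infix 4 _≋_
  _≋_ : ∀ {n} → RingSolver.Expr Carrier n → RingSolver.Expr Carrier n →
        RingSolver.Expr Carrier n × RingSolver.Expr Carrier n
  _≋_ = _⊜_

  ·-cong : ∀ k {x y} → x ≈ y → k · x ≈ k · y
  ·-cong zero x≈y = refl
  ·-cong (suc k) x≈y = +-cong x≈y (·-cong k x≈y)

  2·-double : ∀ x → 2 · x ≈ x + x
  2·-double x = +-cong refl (+-identityʳ x)

  ·-+ : ∀ m n x → (m ℕ.+ n) · x ≈ m · x + n · x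
  ·-+ zero n x = sym (+-identityˡ _)
  ·-+ (suc m) n x = trans (+-cong refl (·-+ m n x)) (sym (+-assoc _ _ _))

  ·-distribˡ : ∀ k x y → k · (x + y) ≈ k · x + k · y
  ·-distribˡ zero x y = sym (+-identityˡ _)
  ·-distribˡ (suc k) x y = trans (+-cong refl (·-distribˡ k x y))
    (ring-solve 4 (λ x y a b → (x ⊕ y) ⊕ (a ⊕ b) ≋ (x ⊕ a) ⊕ (y ⊕ b)) refl x y (k · x) (k · y))

  Σ₁-cong : ∀ y {g g′ : ℕ → Carrier} → (∀ k → g k ≈ g′ k) → Σ₁ y g ≈ Σ₁ y g′
  Σ₁-cong zero g≈ = refl
  Σ₁-cong (suc y) g≈ = +-cong (Σ₁-cong y g≈) (g≈ (suc y))

  Σ₀-cong : ∀ y {g g′ : ℕ → Carrier} → (∀ k → g k ≈ g′ k) → Σ₀ y g ≈ Σ₀ y g′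
  Σ₀-cong zero g≈ = refl
  Σ₀-cong (suc y) g≈ = +-cong (Σ₀-cong y g≈) (g≈ y)

  Σ₁-+ : ∀ y {a b c : ℕ → Carrier} → (∀ k → a k + b k ≈ c k) → Σ₁ y a + Σ₁ y b ≈ Σ₁ y c
  Σ₁-+ zero a+b≈c = +-identityˡ _
  Σ₁-+ (suc y) {a} {b} {c} a+b≈c = begin
      (Σ₁ y a + a (suc y)) + (Σ₁ y b + b (suc y))
    ≈⟨ ring-solve 4 (λ x y z w → (x ⊕ y) ⊕ (z ⊕ w) ≋ (x ⊕ z) ⊕ (y ⊕ w)) refl _ _ _ _ ⟩
      (Σ₁ y a + Σ₁ y b) + (a (suc y) + b (suc y))
    ≈⟨ +-cong (Σ₁-+ y a+b≈c) (a+b≈c (suc y)) ⟩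
      Σ₁ y c + c (suc y) ∎

  Σ₁-as-Σ₀ : ∀ (g : ℕ → Carrier) v y → Σ₁ y (λ k → g (v ℕ.+ k)) ≡ Σ₀ y (λ j → g (suc v ℕ.+ j))
  Σ₁-as-Σ₀ g v zero = P.refl
  Σ₁-as-Σ₀ g v (suc y) = P.cong₂ _+_ (Σ₁-as-Σ₀ g v y) (P.cong g (NP.+-suc v y))

  Σ₀-window : ∀ (g : ℕ → Carrier) s w → Σ₀ w (λ j → g (s ℕ.+ j)) + Σ₀ s g ≈ Σ₀ (s ℕ.+ w) g
  Σ₀-window g s zero = trans (+-identityˡ _) (reflexive (P.cong (λ m → Σ₀ m g) (P.sym (NP.+-identityʳ s))))
  Σ₀-window g s (suc w) = begin
      (Σ₀ w (λ j → g (s ℕ.+ j)) + g (s ℕ.+ w)) + Σ₀ s g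
    ≈⟨ ring-solve 3 (λ a b c → (a ⊕ b) ⊕ c ≋ (a ⊕ c) ⊕ b) refl _ _ _ ⟩
      (Σ₀ w (λ j → g (s ℕ.+ j)) + Σ₀ s g) + g (s ℕ.+ w)
    ≈⟨ +-cong (Σ₀-window g s w) refl ⟩
      Σ₀ (suc (s ℕ.+ w)) g
    ≈⟨ reflexive (P.cong (λ m → Σ₀ m g) (P.sym (NP.+-suc s w))) ⟩
      Σ₀ (s ℕ.+ suc w) g ∎

  Σ₁-window : ∀ (g : ℕ → Carrier) v y → Σ₁ y (λ k → g (v ℕ.+ k)) + Σ₀ (suc v) g ≈ Σ₀ (suc v ℕ.+ y) g
  Σ₁-window g v y = trans (+-cong (reflexive (Σ₁-as-Σ₀ g v y)) refl) (Σ₀-window g (suc v) y)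

  Wsum : ℕ → (ℕ → Carrier) → Carrier
  Wsum y g = Σ₁ y (λ k → (suc y ∸ k) · g k)

  weights-suc : ∀ (g : ℕ → Carrier) t y → y ℕ.≤ t →
    Σ₁ y (λ k → (suc t ∸ k) · g k) ≈ Σ₁ y (λ k → (t ∸ k) · g k) + Σ₁ y g
  weights-suc g t zero _ = sym (+-identityˡ _)
  weights-suc g t (suc y) y<t = begin
      Σ₁ y (λ k → (suc t ∸ k) · g k) + (t ∸ y) · g (suc y)
    ≈⟨ +-cong (weights-suc g t y (NP.≤-trans (NP.n≤1+n y) y<t))
              (reflexive (P.cong (_· g (suc y)) (NP.+-∸-assoc 1 y<t))) ⟩
      (Σ₁ y (λ k → (t ∸ k) · g k) + Σ₁ y g) + (g (suc y) + (t ∸ suc y) · g (suc y))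
    ≈⟨ ring-solve 4 (λ a b c d → (a ⊕ b) ⊕ (c ⊕ d) ≋ (a ⊕ d) ⊕ (b ⊕ c)) refl _ _ _ _ ⟩
      (Σ₁ y (λ k → (t ∸ k) · g k) + (t ∸ suc y) · g (suc y)) + (Σ₁ y g + g (suc y)) ∎

  Wsum-suc : ∀ (g : ℕ → Carrier) y → Wsum (suc y) g ≈ Wsum y g + Σ₁ (suc y) g
  Wsum-suc g y = trans (weights-suc g (suc y) (suc y) NP.≤-refl) (+-cong last-weight-0 refl)
    where
    last-weight-0 : Wsum y g + (y ∸ y) · g (suc y) ≈ Wsum y g
    last-weight-0 = trans (+-cong refl (reflexive (P.cong (_· g (suc y)) (NP.n∸n≡0 y)))) (+-identityʳ _)

  module Prefix (g : ℕ → Carrier) where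
    P₁ Q₂ : ℕ → Carrier
    P₁ m = Σ₀ m g
    Q₂ m = Σ₀ m P₁

    Wsum-prefix : ∀ v y → Wsum y (λ k → g (v ℕ.+ k)) + (y · P₁ (suc v) + Q₂ (2 ℕ.+ v)) ≈ Q₂ (2 ℕ.+ v ℕ.+ y)
    Wsum-prefix v zero = trans (+-identityˡ _) (trans (+-identityˡ _)
      (reflexive (P.cong Q₂ (P.sym (NP.+-identityʳ (2 ℕ.+ v))))))
    Wsum-prefix v (suc y) = begin
        Wsum (suc y) G + ((P₁ (suc v) + y · P₁ (suc v)) + Q₂ (2 ℕ.+ v))
      ≈⟨ +-cong (Wsum-suc G y) refl ⟩
        (Wsum y G + Σ₁ (suc y) G) + ((P₁ (suc v) + y · P₁ (suc v)) + Q₂ (2 ℕ.+ v))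
      ≈⟨ ring-solve 5 (λ a b c d e → (a ⊕ b) ⊕ ((c ⊕ d) ⊕ e) ≋ (a ⊕ (d ⊕ e)) ⊕ (b ⊕ c)) refl _ _ _ _ _ ⟩
        (Wsum y G + (y · P₁ (suc v) + Q₂ (2 ℕ.+ v))) + (Σ₁ (suc y) G + P₁ (suc v))
      ≈⟨ +-cong (Wsum-prefix v y) (Σ₁-window g v (suc y)) ⟩
        Q₂ (2 ℕ.+ v ℕ.+ y) + P₁ (suc v ℕ.+ suc y)
      ≈⟨ +-cong refl (reflexive (P.cong P₁ (P.cong suc (NP.+-suc v y)))) ⟩
        Q₂ (suc (2 ℕ.+ v ℕ.+ y))
      ≈⟨ reflexive (P.cong Q₂ (P.sym (NP.+-suc (2 ℕ.+ v) y))) ⟩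
        Q₂ (2 ℕ.+ v ℕ.+ suc y) ∎
      where
      G : ℕ → Carrier
      G k = g (v ℕ.+ k)

    moment : ∀ v → Σ₁ v (λ k → k · g k) + Q₂ (suc v) ≈ v · P₁ (suc v)
    moment zero = trans (+-identityˡ _) (+-identityˡ _)
    moment (suc v) = begin
        (M + B) + (Q₂ (suc v) + D)
      ≈⟨ ring-solve 4 (λ a b c d → (a ⊕ b) ⊕ (c ⊕ d) ≋ ((a ⊕ c) ⊕ d) ⊕ b) refl _ _ _ _ ⟩
        ((M + Q₂ (suc v)) + D) + B
      ≈⟨ +-cong (trans (+-cong (moment v) refl) (+-comm _ _)) refl ⟩
        suc v · D + suc v · g (suc v)
      ≈⟨ sym (·-distribˡ (suc v) D (g (suc v))) ⟩
        suc v · P₁ (suc (suc v)) ∎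
      where
      M B D : Carrier
      M = Σ₁ v (λ k → k · g k)
      B = suc v · g (suc v)
      D = P₁ (suc v)

    Square : ℕ → Carrier
    Square w = Σ₁ w (λ s → Σ₀ w (λ j → g (s ℕ.+ j)))

    -- Σ_{s=1}^{w} Σ_{j<w} g(s+j) + 2·Q(w+1) = Q(2w+1): row s is P(s+w) − P(s).
    Square-prefix : ∀ w → Square w + (Q₂ (suc w) + Q₂ (suc w)) ≈ Q₂ (suc w ℕ.+ w)
    Square-prefix w = begin
        Square w + (Q₂ (suc w) + Q₂ (suc w))
      ≈⟨ +-cong refl (+-cong (sym (Σ₁-window P₁ 0 w)) refl) ⟩
        Square w + ((Σ₁ w P₁ + Q₂ 1) + Q₂ (suc w))
      ≈⟨ ring-solve 4 (λ a b c d → a ⊕ ((b ⊕ c) ⊕ d) ≋ ((a ⊕ b) ⊕ d) ⊕ c) refl _ _ _ _ ⟩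
        ((Square w + Σ₁ w P₁) + Q₂ (suc w)) + Q₂ 1
      ≈⟨ +-cong (+-cong rows refl) (+-identityˡ 0#) ⟩
        (Σ₁ w (λ s → P₁ (w ℕ.+ s)) + Q₂ (suc w)) + 0#
      ≈⟨ trans (+-identityʳ _) (Σ₁-window P₁ w w) ⟩
        Q₂ (suc w ℕ.+ w) ∎
      where
      rows : Square w + Σ₁ w P₁ ≈ Σ₁ w (λ s → P₁ (w ℕ.+ s))
      rows = Σ₁-+ w (λ s → trans (Σ₀-window g s w) (reflexive (P.cong P₁ (NP.+-comm s w))))

    -- After adding  L·P(v+1) + Q(v+2) + Q(v+1)  to both sides of
    -- T₋(L) + T₊(v) = 2·T₋(u) + S(w), each side telescopes to Q(2w+1) + v·P(v+1).
    splitting : ∀ u v {L w} → L ≡ suc (u ℕ.+ u ℕ.+ v) → w ≡ suc (v ℕ.+ u) →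
      Wsum L (λ k → g (v ℕ.+ k))
        ≈ (2 · Wsum u (λ k → g (v ℕ.+ k)) - Σ₁ v (λ k → k · g k)) + Square w
    splitting u v {L} {w} P.refl P.refl = begin
        Tₗ
      ≈⟨ x≈z//y _ _ _ (∙-cancelʳ Z _ _ (trans lhs+Z (sym rhs+Z))) ⟩
        ((Tᵤ + Tᵤ) + Square w) - M
      ≈⟨ ring-solve 3 (λ t s m → ((t ⊕ t) ⊕ s) ⊕ (⊝ m) ≋ ((t ⊕ t) ⊕ (⊝ m)) ⊕ s) refl Tᵤ (Square w) M ⟩
        ((Tᵤ + Tᵤ) - M) + Square w
      ≈⟨ +-cong (+-cong (sym (2·-double Tᵤ)) refl) refl ⟩
        (2 · Tᵤ - M) + Square w ∎
      where
      G : ℕ → Carrier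
      G k = g (v ℕ.+ k)
      Tₗ Tᵤ M p uP vP Z : Carrier
      Tₗ = Wsum L G
      Tᵤ = Wsum u G
      M = Σ₁ v (λ k → k · g k)
      p = P₁ (suc v)
      uP = u · p
      vP = v · p
      Z = (L · p + Q₂ (2 ℕ.+ v)) + Q₂ (suc v)

      index : 2 ℕ.+ v ℕ.+ L ≡ suc w ℕ.+ w
      index = solve 2 (λ u v → (con 2 :+ v) :+ (con 1 :+ (u :+ u :+ v))
                           := (con 1 :+ (con 1 :+ (v :+ u))) :+ (con 1 :+ (v :+ u))) P.refl u v

      L·p : L · p ≈ ((uP + uP) + vP) + p
      L·p = trans (+-comm _ _) (+-cong (trans (·-+ (u ℕ.+ u) v p) (+-cong (·-+ u u p) refl)) refl)

      lhs+Z : (Tₗ + M) + Z ≈ Q₂ (suc w ℕ.+ w) + vP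
      lhs+Z = begin
          (Tₗ + M) + ((L · p + Q₂ (2 ℕ.+ v)) + Q₂ (suc v))
        ≈⟨ ring-solve 4 (λ t m x q → (t ⊕ m) ⊕ (x ⊕ q) ≋ (t ⊕ x) ⊕ (m ⊕ q)) refl Tₗ M _ _ ⟩
          (Tₗ + (L · p + Q₂ (2 ℕ.+ v))) + (M + Q₂ (suc v))
        ≈⟨ +-cong (trans (Wsum-prefix v L) (reflexive (P.cong Q₂ index))) (moment v) ⟩
          Q₂ (suc w ℕ.+ w) + vP ∎

      rhs+Z : ((Tᵤ + Tᵤ) + Square w) + Z ≈ Q₂ (suc w ℕ.+ w) + vP
      rhs+Z = begin
          ((Tᵤ + Tᵤ) + Square w) + ((L · p + (Q₂ (suc v) + p)) + Q₂ (suc v))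
        ≈⟨ +-cong refl (+-cong (+-cong L·p refl) refl) ⟩
          ((Tᵤ + Tᵤ) + Square w) + (((((uP + uP) + vP) + p) + (Q₂ (suc v) + p)) + Q₂ (suc v))
        ≈⟨ ring-solve 6 (λ t s q p uP vP →
              ((t ⊕ t) ⊕ s) ⊕ (((((uP ⊕ uP) ⊕ vP) ⊕ p) ⊕ (q ⊕ p)) ⊕ q)
            ≋ (s ⊕ ((t ⊕ (uP ⊕ (q ⊕ p))) ⊕ (t ⊕ (uP ⊕ (q ⊕ p))))) ⊕ vP)
            refl Tᵤ (Square w) (Q₂ (suc v)) p uP vP ⟩
          (Square w + ((Tᵤ + (uP + Q₂ (2 ℕ.+ v))) + (Tᵤ + (uP + Q₂ (2 ℕ.+ v))))) + vP
        ≈⟨ +-cong (trans (+-cong refl (+-cong (Wsum-prefix v u) (Wsum-prefix v u))) (Square-prefix w)) refl ⟩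
          Q₂ (suc w ℕ.+ w) + vP ∎

lemma1 : ∀ {c′ ℓ : Level} (R : CommutativeRing c′ ℓ) →
  let open CommutativeRing R
      open Sums R
  in (f : ℤ → Carrier) (per : ℕ) →
     (∀ (m : ℤ) → f (m ℤ.+ + per) ≈ f m) →
     (n : ℕ) (a : ℤ) (N : ℕ) → 1 ℕ.≤ N →
     (τ : ℕ) →
     ⌊ q n ^ τ ∸ 1 /2⌋ ℕ.≤ N →
     N ℕ.< ⌊ q n ^ (1 ℕ.+ τ) ∸ 1 /2⌋ →
     let K : ℕ → ℕ
         K i = ⌊ q n ^ (τ ∸ i) ∸ 1 /2⌋
     in (i : ℕ) → 1 ℕ.≤ i → i ℕ.≤ τ →
        T₋ f a (K (i ∸ 1))
          ≈ ((2 · T₋ f a (qs (1 ℕ.+ n) ℕ.* K i ℕ.+ cs (1 ℕ.+ n))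
              - T₊ f (a ℤ.- + (qs n ℕ.* K i ℕ.+ cs n)) (qs n ℕ.* K i ℕ.+ cs n))
             + S f (a ℤ.- + (qs n ℕ.* K i ℕ.+ cs n))
                   ((qs n ℕ.+ qs (1 ℕ.+ n)) ℕ.* K i ℕ.+ c n ∸ cs (1 ℕ.+ n)))
lemma1 R f _ _ n a _ _ τ _ _ i 1≤i i≤τ = begin
    T₋ f a L
  ≈⟨ rebase-T₋ L ⟩
    Wsum L (λ k → g (V ℕ.+ k))
  ≈⟨ splitting U V (P.trans (K-step n τ i 1≤i i≤τ) long-window) square-side ⟩
    (2 · Wsum U (λ k → g (V ℕ.+ k)) - T₊ f b V) + Square W
  ≈⟨ sym (+-cong (+-cong (·-cong 2 (rebase-T₋ U)) refl) rebase-S) ⟩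
    (2 · T₋ f a U - T₊ f b V) + S f b W ∎
  where
  open CommutativeRing R
  open Sums R
  open Telescoping R
  open Windows n (half (q n ^ (τ ∸ i)))
  open import Relation.Binary.Reasoning.Setoid setoid

  L W : ℕ
  L = half (q n ^ (τ ∸ (i ∸ 1)))
  W = (qs n ℕ.+ qs (1 ℕ.+ n)) ℕ.* half (q n ^ (τ ∸ i)) ℕ.+ c n ∸ cs (1 ℕ.+ n)

  -- Everything is read off from the base point b = a − V.
  b : ℤ
  b = a ℤ.- + V
  g : ℕ → Carrier
  g j = f (b ℤ.+ + j)
  open Prefix g

  rebase-T₋ : ∀ y → T₋ f a y ≈ Wsum y (λ k → g (V ℕ.+ k))
  rebase-T₋ y = Σ₁-cong y (λ k → ·-cong (suc y ∸ k) (reflexive (P.cong f (a+k≡b+[V+k] k))))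
    where
    open ℤSolver.+-*-Solver using () renaming (solve to ℤsolve; _:+_ to _⊹_; _:-_ to _⊟_; _:=_ to _≐_)
    a+k≡b+[V+k] : ∀ k → a ℤ.+ + k ≡ b ℤ.+ + (V ℕ.+ k)
    a+k≡b+[V+k] k = ℤsolve 3 (λ a v k → a ⊹ k ≐ (a ⊟ v) ⊹ (v ⊹ k)) P.refl a (+ V) (+ k)

  rebase-S : S f b W ≈ Square W
  rebase-S = Σ₁-cong W (λ s → Σ₀-cong W (λ j → reflexive (P.cong f (ℤP.+-assoc b (+ s) (+ j)))))
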